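{- Let $G_0$ be a connected bipartite $(p,q)$-graph admitting an odd-edge edge-difference total coloring $h_0$. Then for every positive integer $n$ there is a sequence $G_0,G_1,\dots,G_n$ of connected bipartite graphs such that for each $k\in[1,n]$ the graph $G_k$ is obtained from $G_{k-1}$ by adding $a_k\geq 1$ leaves and admits an odd-edge edge-difference total coloring $h_k$, and moreover $h_i(V(G_i))\cap h_j(V(G_j))\neq\emptyset$ for all $i,j\in[0,n]$.
   Context: A $(p,q)$-graph has $p$ vertices and $q$ edges; $[a,b]=\{a,\dots,b\}$ and $[1,2q-1]^o$ denotes the set of odd integers in $[1,2q-1]$; $h(S)=\{h(s):s\in S\}$. Adding a leaf to a graph $H$ means adding a new vertex $w$ and an edge $xw$ for some $x\in V(H)$. For a bipartite $(p,q)$-graph $H$ with $q\ge1$, an odd-edge edge-difference total coloring is a map $h:V(H)\cup E(H)\to[0,2q-1]$ (vertex colors need not be distinct) such that $h(E(H))=[1,2q-1]^o$ and there is a positive integer $k$ with $h(uv)+|h(u)-h(v)|=k$ for every edge $uv\in E(H)$. -}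

module Defs where

open import Data.Nat using (ℕ; zero; suc; _+_; _*_; _∸_; _≤_; _<_; ∣_-_∣)
open import Data.Fin using (Fin; _↑ˡ_; _↑ʳ_)
open import Data.Bool using (Bool)
open import Data.List using (List; length; map; _++_; allFin)
open import Data.List.Membership.Propositional using (_∈_; _∉_)
open import Data.List.Relation.Unary.Unique.Propositional using (Unique)
open import Data.Product using (Σ; ∃; ∃-syntax; _×_; _,_; proj₁; proj₂)
open import Data.Sum using (_⊎_)
open import Relation.Nullary using (¬_)
open import Relation.Binary.PropositionalEquality using (_≡_; _≢_)
open import Relation.Binary.Construct.Closure.ReflexiveTransitive using (Star)

-- A finite graph: vertex set Fin p, edge list (each edge uv stored once as a pair).
record Graph : Set where
  constructor mkGraph
  field
    p     : ℕ
    edges : List (Fin p × Fin p)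
open Graph public

q : Graph → ℕ
q G = length (edges G)

Simple : Graph → Set
Simple G = (∀ {u v} → (u , v) ∈ edges G → u ≢ v)
         × Unique (edges G)
         × (∀ {u v} → (u , v) ∈ edges G → (v , u) ∉ edges G)

Adj : (G : Graph) → Fin (p G) → Fin (p G) → Set
Adj G u v = ((u , v) ∈ edges G) ⊎ ((v , u) ∈ edges G)

Connected : Graph → Set
Connected G = ∀ (u v : Fin (p G)) → Star (Adj G) u v

Bipartite : Graph → Set
Bipartite G = Σ (Fin (p G) → Bool) (λ c → ∀ {u v} → (u , v) ∈ edges G → c u ≢ c v)

Odd : ℕ → Set
Odd m = ∃[ j ] (m ≡ suc (2 * j))

record OEEDTC (G : Graph) : Set where
  field
    q≥1     : 1 ≤ q G
    hv      : Fin (p G) → ℕ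
    he      : Fin (p G) × Fin (p G) → ℕ
    hv-rng  : ∀ u → hv u ≤ 2 * q G ∸ 1
    he-odd  : ∀ {e} → e ∈ edges G → Odd (he e) × he e ≤ 2 * q G ∸ 1
    he-onto : ∀ m → Odd m → m ≤ 2 * q G ∸ 1 → ∃[ e ] (e ∈ edges G × he e ≡ m)
    k       : ℕ
    k>0     : 0 < k
    diff    : ∀ {u v} → (u , v) ∈ edges G → he (u , v) + ∣ hv u - hv v ∣ ≡ k
open OEEDTC public

ColoredGraph : Set
ColoredGraph = Σ Graph OEEDTC

-- add a leaves to G: new vertices p, ..., p+a-1, the i-th joined to the old vertex x i
addLeaves : (G : Graph) (a : ℕ) → (Fin a → Fin (p G)) → Graph
addLeaves G a x = mkGraph (p G + a)
  (map (λ e → (proj₁ e ↑ˡ a) , (proj₂ e ↑ˡ a)) (edges G)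
   ++ map (λ i → (x i ↑ˡ a) , (p G ↑ʳ i)) (allFin a))

AddsLeaves : Graph → Graph → Set
AddsLeaves G H = ∃[ a ] (1 ≤ a × ∃[ x ] (H ≡ addLeaves G a x))

VertexColorsMeet : ColoredGraph → ColoredGraph → Set
VertexColorsMeet (G , h) (H , h') = ∃[ u ] ∃[ v ] (hv h u ≡ hv h' v)

{-# OPTIONS --safe #-}
module Submission where

-- Adding one leaf at a time suffices. Given an odd-edge edge-difference total
-- colouring h of G with constant k, the edge coloured 1 joins vertices a, b with
-- |h(a) − h(b)| = k − 1; say h(a) ≤ h(b). Hang a new leaf w on a, raise every old
-- edge colour by 2, colour the new edge 1 and w with h(a) + k + 1 = h(b) + 2 ≤ 2q + 1.
-- This is a colouring of the new (p + 1, q + 1)-graph with constant k + 2 that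
-- leaves all old vertex colours unchanged, so a vertex colour of G₀ occurs in
-- every graph of the sequence.

open import Defs
open import Data.Nat using (ℕ; zero; suc; _+_; _*_; _∸_; _≤_; _<_; z≤n; s≤s; ∣_-_∣)
open import Data.Nat.Properties
open import Data.Fin using (Fin; _↑ˡ_; _↑ʳ_; splitAt) renaming (zero to fzero)
open import Data.Fin.Properties using (splitAt-↑ˡ; splitAt-↑ʳ; splitAt⁻¹-↑ˡ; splitAt⁻¹-↑ʳ; ↑ˡ-injective)
open import Data.Bool using (Bool; true; false; not)
open import Data.List using ([]; _∷_; length; map)
open import Data.List.Properties using (length-++; length-map)
open import Data.List.Membership.Propositional using (_∈_; _∉_)
open import Data.List.Membership.Propositional.Properties using (∈-map⁺; ∈-map⁻; ∈-++⁺ˡ; ∈-++⁺ʳ; ∈-++⁻)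
open import Data.List.Relation.Unary.Any using (here)
open import Data.List.Relation.Unary.All using ([])
open import Data.List.Relation.Unary.AllPairs using ([]; _∷_)
open import Data.List.Relation.Unary.Unique.Propositional using (Unique)
import Data.List.Relation.Unary.Unique.Propositional.Properties as Unique
open import Data.Product using (Σ; Σ-syntax; ∃-syntax; _×_; _,_; proj₁; proj₂)
open import Data.Sum using (_⊎_; inj₁; inj₂; [_,_])
open import Relation.Nullary using (¬_)
open import Relation.Binary.PropositionalEquality hiding ([_])
open import Relation.Binary.Construct.Closure.ReflexiveTransitive using (Star; ε; _◅_; _◅◅_; gmap)

Odd-2+ : ∀ {m} → Odd m → Odd (2 + m)
Odd-2+ (j , refl) = suc j , cong suc (sym (*-suc 2 j))

1≤2*n∸1 : ∀ {n} → 1 ≤ n → 1 ≤ 2 * n ∸ 1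
1≤2*n∸1 {suc n} _ = ≤-trans (s≤s z≤n) (m≤n+m (suc (n + 0)) n)

2*[1+n]∸1≡2+[2*n∸1] : ∀ {n} → 1 ≤ n → 2 * suc n ∸ 1 ≡ 2 + (2 * n ∸ 1)
2*[1+n]∸1≡2+[2*n∸1] {n} 1≤n = begin
  2 * suc n ∸ 1     ≡⟨ cong (_∸ 1) (*-suc 2 n) ⟩
  (2 + 2 * n) ∸ 1   ≡⟨ +-∸-assoc 2 (≤-trans 1≤n (m≤m+n n (n + 0))) ⟩
  2 + (2 * n ∸ 1)   ∎
  where open ≡-Reasoning

m≤n≤b⇒m+[1+k]≤2+b : ∀ {m n b k} → m ≤ n → n ≤ b → suc ∣ m - n ∣ ≡ k → m + suc k ≤ 2 + b
m≤n≤b⇒m+[1+k]≤2+b {m} {n} {b} {k} m≤n n≤b 1+∣m-n∣≡k = begin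
  m + suc k                 ≡⟨ cong (λ t → m + suc t) (sym 1+∣m-n∣≡k) ⟩
  m + suc (suc ∣ m - n ∣)   ≡⟨ trans (+-suc m _) (cong suc (+-suc m _)) ⟩
  2 + (m + ∣ m - n ∣)       ≡⟨ cong (2 +_) (cong (m +_) (m≤n⇒∣m-n∣≡n∸m m≤n)) ⟩
  2 + (m + (n ∸ m))         ≡⟨ cong (2 +_) (m+[n∸m]≡n m≤n) ⟩
  2 + n                     ≤⟨ s≤s (s≤s n≤b) ⟩
  2 + b                     ∎
  where open ≤-Reasoning

module AddLeaf (G : Graph) (x : Fin (p G)) where

  G⁺ : Graph
  G⁺ = addLeaves G 1 (λ _ → x)

  old : Fin (p G) → Fin (p G⁺)
  old u = u ↑ˡ 1

  leaf : Fin (p G⁺)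
  leaf = p G ↑ʳ fzero

  oldEdge : Fin (p G) × Fin (p G) → Fin (p G⁺) × Fin (p G⁺)
  oldEdge (u , v) = old u , old v

  newEdge : Fin (p G⁺) × Fin (p G⁺)
  newEdge = old x , leaf

  extend : {A : Set} → (Fin (p G) → A) → A → Fin (p G⁺) → A
  extend f a i = [ f , (λ _ → a) ] (splitAt (p G) i)

  extend-old : ∀ {A : Set} (f : Fin (p G) → A) a u → extend f a (old u) ≡ f u
  extend-old f a u = cong [ f , (λ _ → a) ] (splitAt-↑ˡ (p G) u 1)

  extend-leaf : ∀ {A : Set} (f : Fin (p G) → A) a → extend f a leaf ≡ a
  extend-leaf f a = cong [ f , (λ _ → a) ] (splitAt-↑ʳ (p G) 1 fzero)

  old≢leaf : ∀ u → old u ≢ leaf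
  old≢leaf u eq with trans (sym (extend-old (λ _ → true) false u))
                           (trans (cong (extend (λ _ → true) false) eq) (extend-leaf (λ _ → true) false))
  ... | ()

  old-or-leaf : ∀ i → (∃[ u ] old u ≡ i) ⊎ leaf ≡ i
  old-or-leaf i with splitAt (p G) i in eq
  ... | inj₁ u      = inj₁ (u , splitAt⁻¹-↑ˡ eq)
  ... | inj₂ fzero  = inj₂ (splitAt⁻¹-↑ʳ eq)

  oldEdge-injective : ∀ {e e′} → oldEdge e ≡ oldEdge e′ → e ≡ e′
  oldEdge-injective eq = cong₂ _,_ (↑ˡ-injective 1 _ _ (cong proj₁ eq)) (↑ˡ-injective 1 _ _ (cong proj₂ eq))

  oldEdge-∈ : ∀ {e} → e ∈ edges G → oldEdge e ∈ edges G⁺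
  oldEdge-∈ e∈ = ∈-++⁺ˡ (∈-map⁺ oldEdge e∈)

  newEdge-∈ : newEdge ∈ edges G⁺
  newEdge-∈ = ∈-++⁺ʳ (map oldEdge (edges G)) (here refl)

  ∈-edges⁻ : ∀ {e} → e ∈ edges G⁺ → (∃[ e₀ ] (e₀ ∈ edges G × e ≡ oldEdge e₀)) ⊎ e ≡ newEdge
  ∈-edges⁻ e∈ with ∈-++⁻ (map oldEdge (edges G)) e∈
  ... | inj₁ e∈old         = inj₁ (∈-map⁻ oldEdge e∈old)
  ... | inj₂ (here e≡new)  = inj₂ e≡new

  q-G⁺ : q G⁺ ≡ suc (q G)
  q-G⁺ = begin
    q G⁺                                 ≡⟨ length-++ (map oldEdge (edges G)) ⟩
    length (map oldEdge (edges G)) + 1  ≡⟨ cong (_+ 1) (length-map oldEdge (edges G)) ⟩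
    q G + 1                              ≡⟨ +-comm (q G) 1 ⟩
    suc (q G)                            ∎
    where open ≡-Reasoning

  simple : Simple G → Simple G⁺
  simple (loopless , unique , antisymmetric) = loopless⁺ , unique⁺ , antisymmetric⁺
    where
    loopless⁺ : ∀ {u v} → (u , v) ∈ edges G⁺ → u ≢ v
    loopless⁺ uv∈ u≡v with ∈-edges⁻ uv∈
    ... | inj₁ (_ , e∈ , refl) = loopless e∈ (↑ˡ-injective 1 _ _ u≡v)
    ... | inj₂ refl            = old≢leaf x u≡v

    newEdge∉old : ∀ {e} → ¬ (e ∈ map oldEdge (edges G) × e ∈ newEdge ∷ [])
    newEdge∉old (e∈old , here refl) with ∈-map⁻ oldEdge e∈old
    ... | _ , _ , eq = old≢leaf _ (sym (cong proj₂ eq))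

    unique⁺ : Unique (edges G⁺)
    unique⁺ = Unique.++⁺ (Unique.map⁺ oldEdge-injective unique) ([] ∷ []) newEdge∉old

    antisymmetric⁺ : ∀ {u v} → (u , v) ∈ edges G⁺ → (v , u) ∉ edges G⁺
    antisymmetric⁺ uv∈ vu∈ with ∈-edges⁻ uv∈ | ∈-edges⁻ vu∈
    ... | inj₁ (_ , e∈ , refl) | inj₁ (_ , e′∈ , eq) = antisymmetric e∈ (subst (_∈ edges G) (oldEdge-injective (sym eq)) e′∈)
    ... | inj₁ (_ , _ , refl)  | inj₂ eq             = old≢leaf _ (cong proj₂ eq)
    ... | inj₂ refl            | inj₁ (_ , _ , eq)   = old≢leaf _ (sym (cong proj₁ eq))
    ... | inj₂ refl            | inj₂ eq             = old≢leaf x (sym (cong proj₁ eq))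

  connected : Connected G → Connected G⁺
  connected path i j = to-x i ◅◅ from-x j
    where
    lift : ∀ {u v} → Star (Adj G) u v → Star (Adj G⁺) (old u) (old v)
    lift = gmap old [ (λ e∈ → inj₁ (oldEdge-∈ e∈)) , (λ e∈ → inj₂ (oldEdge-∈ e∈)) ]

    to-x : ∀ i → Star (Adj G⁺) i (old x)
    to-x i with old-or-leaf i
    ... | inj₁ (u , refl) = lift (path u x)
    ... | inj₂ refl       = inj₂ newEdge-∈ ◅ ε

    from-x : ∀ i → Star (Adj G⁺) (old x) i
    from-x i with old-or-leaf i
    ... | inj₁ (u , refl) = lift (path x u)
    ... | inj₂ refl       = inj₁ newEdge-∈ ◅ ε

  bipartite : Bipartite G → Bipartite G⁺
  bipartite (side , proper) = side⁺ , proper⁺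
    where
    side⁺ : Fin (p G⁺) → Bool
    side⁺ = extend side (not (side x))

    b≢not-b : ∀ b → b ≢ not b
    b≢not-b true  ()
    b≢not-b false ()

    proper⁺ : ∀ {u v} → (u , v) ∈ edges G⁺ → side⁺ u ≢ side⁺ v
    proper⁺ uv∈ eq with ∈-edges⁻ uv∈
    ... | inj₁ ((a , b) , e∈ , refl) =
      proper e∈ (trans (sym (extend-old side _ a)) (trans eq (extend-old side _ b)))
    ... | inj₂ refl =
      b≢not-b (side x) (trans (sym (extend-old side _ x)) (trans eq (extend-leaf side _)))

module ExtendColouring (G : Graph) (h : OEEDTC G) where

  bound : ℕ
  bound = 2 * q G ∸ 1

  diff-on-colour-1 : ∀ {a b} → (a , b) ∈ edges G → he h (a , b) ≡ 1 → suc ∣ hv h a - hv h b ∣ ≡ k h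
  diff-on-colour-1 {a} {b} ab∈ he≡1 = trans (cong (_+ ∣ hv h a - hv h b ∣) (sym he≡1)) (diff h ab∈)

  anchor : Σ[ x ∈ Fin (p G) ] hv h x + suc (k h) ≤ 2 + bound
  anchor with he-onto h 1 (0 , refl) (1≤2*n∸1 (q≥1 h))
  ... | (a , b) , ab∈ , he≡1 with ≤-total (hv h a) (hv h b)
  ... | inj₁ a≤b = a , m≤n≤b⇒m+[1+k]≤2+b a≤b (hv-rng h b) (diff-on-colour-1 ab∈ he≡1)
  ... | inj₂ b≤a = b , m≤n≤b⇒m+[1+k]≤2+b b≤a (hv-rng h a)
                         (trans (cong suc (∣-∣-comm (hv h b) (hv h a))) (diff-on-colour-1 ab∈ he≡1))

  x : Fin (p G)
  x = proj₁ anchor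

  open AddLeaf G x public

  hv⁺ : Fin (p G⁺) → ℕ
  hv⁺ = extend (hv h) (hv h x + suc (k h))

  he⁺ : Fin (p G⁺) × Fin (p G⁺) → ℕ
  he⁺ (i , j) = extend (λ u → extend (λ v → 2 + he h (u , v)) 1 j) 1 i

  hv⁺-old : ∀ u → hv⁺ (old u) ≡ hv h u
  hv⁺-old = extend-old (hv h) _

  he⁺-old : ∀ e → he⁺ (oldEdge e) ≡ 2 + he h e
  he⁺-old (u , v) = trans (extend-old _ 1 u) (extend-old _ 1 v)

  he⁺-new : he⁺ newEdge ≡ 1
  he⁺-new = trans (extend-old _ 1 x) (extend-leaf _ 1)

  bound⁺ : 2 * q G⁺ ∸ 1 ≡ 2 + bound
  bound⁺ = trans (cong (λ m → 2 * m ∸ 1) q-G⁺) (2*[1+n]∸1≡2+[2*n∸1] (q≥1 h))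

  hv⁺-range : ∀ u → hv⁺ u ≤ 2 + bound
  hv⁺-range u with old-or-leaf u
  ... | inj₁ (a , refl) = subst (_≤ 2 + bound) (sym (hv⁺-old a)) (≤-trans (hv-rng h a) (m≤n+m bound 2))
  ... | inj₂ refl       = subst (_≤ 2 + bound) (sym (extend-leaf (hv h) _)) (proj₂ anchor)

  he⁺-odd : ∀ {e} → e ∈ edges G⁺ → Odd (he⁺ e) × he⁺ e ≤ 2 + bound
  he⁺-odd e∈ with ∈-edges⁻ e∈
  ... | inj₁ (e₀ , e₀∈ , refl) rewrite he⁺-old e₀ with he-odd h e₀∈
  ...   | odd , ≤bound = Odd-2+ odd , s≤s (s≤s ≤bound)
  he⁺-odd e∈ | inj₂ refl rewrite he⁺-new = (0 , refl) , s≤s z≤n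

  he⁺-onto : ∀ m → Odd m → m ≤ 2 + bound → ∃[ e ] (e ∈ edges G⁺ × he⁺ e ≡ m)
  he⁺-onto _ (zero , refl) _ = newEdge , newEdge-∈ , he⁺-new
  he⁺-onto (suc (suc m)) (suc j , eq) (s≤s (s≤s m≤bound))
    with he-onto h m (j , suc-injective (trans (suc-injective eq) (*-suc 2 j))) m≤bound
  ... | e₀ , e₀∈ , he≡m = oldEdge e₀ , oldEdge-∈ e₀∈ , trans (he⁺-old e₀) (cong (2 +_) he≡m)

  he⁺-diff : ∀ {u v} → (u , v) ∈ edges G⁺ → he⁺ (u , v) + ∣ hv⁺ u - hv⁺ v ∣ ≡ 2 + k h
  he⁺-diff uv∈ with ∈-edges⁻ uv∈
  ... | inj₁ ((a , b) , ab∈ , refl) rewrite he⁺-old (a , b) | hv⁺-old a | hv⁺-old b =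
    cong (2 +_) (diff h ab∈)
  ... | inj₂ refl rewrite he⁺-new | hv⁺-old x | extend-leaf (hv h) (hv h x + suc (k h)) =
    cong suc (∣m-m+n∣≡n (hv h x) (suc (k h)))

  colouring : OEEDTC G⁺
  colouring = record
    { q≥1     = subst (1 ≤_) (sym q-G⁺) (s≤s z≤n)
    ; hv      = hv⁺
    ; he      = he⁺
    ; hv-rng  = λ u → subst (hv⁺ u ≤_) (sym bound⁺) (hv⁺-range u)
    ; he-odd  = λ {e} e∈ → let odd , ≤bound = he⁺-odd e∈ in odd , subst (he⁺ e ≤_) (sym bound⁺) ≤bound
    ; he-onto = λ m odd m≤ → he⁺-onto m odd (subst (m ≤_) bound⁺ m≤)
    ; k       = 2 + k h
    ; k>0     = s≤s z≤n
    ; diff    = he⁺-diff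
    }

addLeafColoured : ColoredGraph → ColoredGraph
addLeafColoured (G , h) = ExtendColouring.G⁺ G h , ExtendColouring.colouring G h

module LeafChain (G₀ : Graph) (h₀ : OEEDTC G₀) where

  chain : ℕ → ColoredGraph
  chain zero    = G₀ , h₀
  chain (suc i) = addLeafColoured (chain i)

  chain-addsLeaves : ∀ i → AddsLeaves (proj₁ (chain i)) (proj₁ (chain (suc i)))
  chain-addsLeaves i = 1 , s≤s z≤n , (λ _ → ExtendColouring.x (proj₁ (chain i)) (proj₂ (chain i))) , refl

  chain-preserves : (P : Graph → Set) → (∀ G x → P G → P (AddLeaf.G⁺ G x))
                  → P G₀ → ∀ i → P (proj₁ (chain i))
  chain-preserves P step P₀ zero    = P₀
  chain-preserves P step P₀ (suc i) = step _ _ (chain-preserves P step P₀ i)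

  base : Fin (p G₀)
  base = ExtendColouring.x G₀ h₀

  base-colour-persists : ∀ i → Σ[ v ∈ Fin (p (proj₁ (chain i))) ] hv (proj₂ (chain i)) v ≡ hv h₀ base
  base-colour-persists zero    = base , refl
  base-colour-persists (suc i) = old v , trans (hv⁺-old v) v-colour
    where
    open ExtendColouring (proj₁ (chain i)) (proj₂ (chain i))
    v = proj₁ (base-colour-persists i)
    v-colour = proj₂ (base-colour-persists i)

  chain-coloursMeet : ∀ i j → VertexColorsMeet (chain i) (chain j)
  chain-coloursMeet i j with base-colour-persists i | base-colour-persists j
  ... | u , u-colour | v , v-colour = u , v , trans u-colour (sym v-colour)

mainTheorem6 : (G₀ : Graph) → Simple G₀ → Connected G₀ → Bipartite G₀ → (h₀ : OEEDTC G₀)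
    → (n : ℕ) → 1 ≤ n
    → Σ (ℕ → ColoredGraph) (λ S →
        (S 0 ≡ (G₀ , h₀))
        × (∀ i → i ≤ n → Simple (proj₁ (S i)) × Connected (proj₁ (S i)) × Bipartite (proj₁ (S i)))
        × (∀ k → k < n → AddsLeaves (proj₁ (S k)) (proj₁ (S (suc k))))
        × (∀ i j → i ≤ n → j ≤ n → VertexColorsMeet (S i) (S j)))
mainTheorem6 G₀ simple₀ connected₀ bipartite₀ h₀ n _ =
  chain , refl , (λ i _ → graph-properties i) , (λ i _ → chain-addsLeaves i) , (λ i j _ _ → chain-coloursMeet i j)
  where
  open LeafChain G₀ h₀
  graph-properties : ∀ i → Simple (proj₁ (chain i)) × Connected (proj₁ (chain i)) × Bipartite (proj₁ (chain i))
  graph-properties i = chain-preserves Simple AddLeaf.simple simple₀ i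
                     , chain-preserves Connected AddLeaf.connected connected₀ i
                     , chain-preserves Bipartite AddLeaf.bipartite bipartite₀ i
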